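{- Let $\mu=(\mathrm{Val},(\mathcal P,\mathcal O),\varsigma)$ be a model for the predicate symbols $\mathrm{broadcast},\mathrm{echo},\mathrm{ready},\mathrm{deliver}$ whose semitopology is 3-twined, and suppose every axiom of $\mathrm{ThyBB}$ is valid in $\mu$. Let $v\in\mathrm{Val}$. Then: (1) $\models\mathsf{Somewhere}\,\mathrm{broadcast}(v)\to_w\mathrm{echo}(v)$; (2) $\models\mathsf{Somewhere}\,\mathrm{broadcast}(v)\to_w\mathsf{Everywhere}\,\mathrm{echo}(v)$; (3) $\models\mathsf{Quorum}\,\mathrm{echo}(v)\to_w\mathsf{Everywhere}\,\mathrm{ready}(v)$; (4) $\models\mathsf{Quorum}\,\mathrm{ready}(v)\to_w\mathsf{Everywhere}\,\mathrm{deliver}(v)$.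
   Context: Truth values: $\mathbf 3=\{\mathbf f,\mathbf b,\mathbf t\}$ totally ordered by $\mathbf f<\mathbf b<\mathbf t$; $\wedge,\vee$ are min and max, $\bigwedge,\bigvee$ are infimum and supremum. Negation: $\neg\mathbf t=\mathbf f$, $\neg\mathbf b=\mathbf b$, $\neg\mathbf f=\mathbf t$. Modalities: $\mathsf T x=\mathbf t$ if $x=\mathbf t$, else $\mathbf f$; $\mathsf B x=\mathbf t$ if $x=\mathbf b$, else $\mathbf f$; $\mathsf{TF}x=\mathbf t$ if $x\in\{\mathbf t,\mathbf f\}$, else $\mathbf f$. Weak implication: $x\to_w y:=\neg x\vee y$. A truth value is valid iff it lies in $\{\mathbf t,\mathbf b\}$. A semitopology $(\mathcal P,\mathcal O)$ is a set $\mathcal P$ with a family $\mathcal O$ of subsets containing $\mathcal P$ and closed under arbitrary (including empty) unions; $\mathcal O^{\neq\emptyset}$ is the set of nonempty members. It is 3-twined if any three members of $\mathcal O^{\neq\emptyset}$ have nonempty intersection. For $f:\mathcal P\to\mathbf 3$: $\mathsf{Everywhere} f=\bigwedge_{p}f(p)$, $\mathsf{Somewhere} f=\bigvee_p f(p)$, $\mathsf{Quorum} f=\bigvee_{O\in\mathcal O^{\neq\emptyset}}\bigwedge_{p\in O}f(p)$, $\mathsf{Contraquorum} f=\bigwedge_{O\in\mathcal O^{\neq\emptyset}}\bigvee_{p\in O}f(p)$. Logic: a model $\mu=(\mathrm{Val},(\mathcal P,\mathcal O),\varsigma)$ consists of a nonempty set $\mathrm{Val}$, a semitopology, and for each predicate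 symbol $R$ a function $\varsigma(R):\mathcal P\to\mathrm{Val}\to\mathbf 3$. Formulas are built from atoms $R(t)$, value equalities $v\doteq v'$ (denoting $\mathbf t$ if $v=v'$, else $\mathbf f$), connectives $\neg,\wedge,\vee,\to_w$, modalities $\mathsf T,\mathsf B,\mathsf{TF}$, operators $\mathsf{Everywhere},\mathsf{Somewhere},\mathsf{Quorum},\mathsf{Contraquorum}$ and quantifiers over $\mathrm{Val}$. Denotation $[\![\phi]\!]:\mathcal P\to\mathbf 3$: $[\![R(v)]\!](p)=\varsigma(R)(p)(v)$; connectives and modalities pointwise in $p$; $[\![\mathsf{Quorum}\,\phi]\!](p)=\mathsf{Quorum}([\![\phi]\!])$ for all $p$, likewise for the other three operators; $[\![\exists a.\phi]\!](p)=\bigvee_{v}[\![\phi[a:=v]]\!](p)$, $[\![\forall a.\phi]\!](p)=\bigwedge_{v}[\![\phi[a:=v]]\!](p)$; $[\![\exists_{01}a.\phi]\!](p)=\bigwedge_{v,v'}\big(([\![\phi[a:=v]]\!](p)\wedge[\![\phi[a:=v']]\!](p))\to_w (v\doteq v')\big)$; $\exists_1 a.\phi:=(\exists_{01}a.\phi)\wedge(\exists a.\phi)$. $p\models\phi$ iff $[\![\phi]\!](p)\in\{\mathbf t,\mathbf b\}$; $\models\phi$ iff $p\models\phi$ for all $p$. $\mathrm{correct}(R):=\forall a.\mathsf{TF}R(a)$, $\mathrm{incorrect}(R):=\forall a.\mathsf B R(a)$. Axioms with a free variable $a$ are universally quantified over $a$; an axiom is valid in $\mu$ if $\models$ it. $\mathrm{ThyBB}$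 consists of: BrDeliver?: $\mathrm{deliver}(a)\to_w\mathsf{Quorum}\,\mathrm{ready}(a)$; BrReady?: $\mathrm{ready}(a)\to_w\mathsf{Quorum}\,\mathrm{echo}(a)$; BrEcho?: $\mathrm{echo}(a)\to_w\mathsf{Somewhere}\,\mathrm{broadcast}(a)$; BrEcho01: $\exists_{01}a.\mathrm{echo}(a)$; BrBroadcast1: $\exists_1 a.\mathsf{Somewhere}\,\mathrm{broadcast}(a)$; BrDeliver!: $\mathsf{Quorum}\,\mathrm{ready}(a)\to_w\mathrm{deliver}(a)$; BrReady!: $\mathsf{Quorum}\,\mathrm{echo}(a)\to_w\mathrm{ready}(a)$; BrEcho!: $\mathsf{Somewhere}\,\mathrm{broadcast}(a)\to_w\exists a.\mathrm{echo}(a)$; BrReady!!: $\mathsf{Contraquorum}\,\mathrm{ready}(a)\to_w\mathrm{ready}(a)$; BrCorrect: $\mathsf{Quorum}\,\mathrm{correct}(\mathrm{ready})\wedge\mathsf{Quorum}\,\mathrm{correct}(\mathrm{echo})$; BrCorrect': $\mathrm{correct}(R)\vee\mathrm{incorrect}(R)$ for $R\in\{\mathrm{ready},\mathrm{echo}\}$; BrCorrect'': $\mathsf{Everywhere}\,\mathrm{correct}(\mathrm{broadcast})\vee\mathsf{Everywhere}\,\mathrm{incorrect}(\mathrm{broadcast})$. -}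

module Defs where

open import Data.Empty using (⊥)
open import Data.Unit using (⊤)
open import Data.Product using (Σ; _×_; _,_; proj₁; proj₂)
open import Function.Bundles using (_⇔_)
open import Relation.Nullary using (Dec; yes; no)
open import Relation.Binary.PropositionalEquality using (_≡_)

-- Classical logic is supplied as an explicit hypothesis: the paper works
-- classically (arbitrary infima/suprema in 𝟛, decidable equality of
-- values).

EM : Set₁
EM = (A : Set) → Dec A

-- Truth values 𝟛 = {𝐟 < 𝐛 < 𝐭}

data 𝟛 : Set where
  𝐟 𝐛 𝐭 : 𝟛

_∧₃_ : 𝟛 → 𝟛 → 𝟛
𝐟 ∧₃ y = 𝐟
𝐛 ∧₃ 𝐟 = 𝐟
𝐛 ∧₃ 𝐛 = 𝐛
𝐛 ∧₃ 𝐭 = 𝐛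
𝐭 ∧₃ y = y

_∨₃_ : 𝟛 → 𝟛 → 𝟛
𝐟 ∨₃ y = y
𝐛 ∨₃ 𝐟 = 𝐛
𝐛 ∨₃ 𝐛 = 𝐛
𝐛 ∨₃ 𝐭 = 𝐭
𝐭 ∨₃ y = 𝐭

infixr 7 _∧₃_
infixr 6 _∨₃_
infixr 5 _→w_

¬₃ : 𝟛 → 𝟛
¬₃ 𝐭 = 𝐟
¬₃ 𝐛 = 𝐛
¬₃ 𝐟 = 𝐭

_→w_ : 𝟛 → 𝟛 → 𝟛
x →w y = ¬₃ x ∨₃ y

𝖳 : 𝟛 → 𝟛
𝖳 𝐭 = 𝐭
𝖳 𝐛 = 𝐟
𝖳 𝐟 = 𝐟

𝖡 : 𝟛 → 𝟛
𝖡 𝐭 = 𝐟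
𝖡 𝐛 = 𝐭
𝖡 𝐟 = 𝐟

𝖳𝖥 : 𝟛 → 𝟛
𝖳𝖥 𝐭 = 𝐭
𝖳𝖥 𝐛 = 𝐟
𝖳𝖥 𝐟 = 𝐭

Valid : 𝟛 → Set
Valid 𝐟 = ⊥
Valid 𝐛 = ⊤
Valid 𝐭 = ⊤

if? : {A : Set} → Dec A → 𝟛 → 𝟛 → 𝟛
if? (yes _) x y = x
if? (no _)  x y = y

⋀ : EM → {I : Set} → (I → 𝟛) → 𝟛
⋀ em {I} g = if? (em ((i : I) → g i ≡ 𝐭)) 𝐭
               (if? (em ((i : I) → Valid (g i))) 𝐛 𝐟)

⋁ : EM → {I : Set} → (I → 𝟛) → 𝟛
⋁ em {I} g = if? (em (Σ I λ i → g i ≡ 𝐭)) 𝐭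
               (if? (em (Σ I λ i → Valid (g i))) 𝐛 𝐟)

-- The family 𝒪 of open sets is presented as an indexed
-- family  open : Ix → (Pt → Set)  (an open set is  open k  for some k).
-- It contains the whole space and is closed under arbitrary unions of
-- subfamilies (a subfamily is a predicate S on indices; S = ∅ gives the
-- empty union).

record Semitopology : Set₁ where
  field
    Pt    : Set
    Ix    : Set
    open? : Ix → Pt → Set
    whole : Σ Ix λ k → (p : Pt) → open? k p
    union : (S : Ix → Set) →
            Σ Ix λ k → (p : Pt) → open? k p ⇔ (Σ Ix λ i → S i × open? i p)

  NonEmpty : Ix → Set
  NonEmpty k = Σ Pt (open? k)

  Open≠∅ : Set
  Open≠∅ = Σ Ix NonEmpty

  Pts : Ix → Set
  Pts k = Σ Pt (open? k)

ThreeTwined : Semitopology → Set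
ThreeTwined S = (k₁ k₂ k₃ : Ix) → NonEmpty k₁ → NonEmpty k₂ → NonEmpty k₃ →
                Σ Pt λ p → open? k₁ p × open? k₂ p × open? k₃ p
  where open Semitopology S

record Model : Set₁ where
  field
    Val       : Set
    val₀      : Val
    space     : Semitopology
  open Semitopology space public
  field
    broadcast echo ready deliver : Pt → Val → 𝟛

-- Semantics.  A (closed) formula denotes a function  Pt → 𝟛 ; a formula
-- with one free value variable denotes  Val → Pt → 𝟛 .

module Sem (em : EM) (M : Model) where
  open Model M public

  Form : Set
  Form = Pt → 𝟛

  ⊨_ : Form → Set
  ⊨ φ = (p : Pt) → Valid (φ p)

  Everywhere Somewhere Quorum Contraquorum : Form → 𝟛
  Everywhere φ = ⋀ em φ
  Somewhere  φ = ⋁ em φ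
  Quorum       φ = ⋁ em {Open≠∅} λ O → ⋀ em {Pts (proj₁ O)} λ q → φ (proj₁ q)
  Contraquorum φ = ⋀ em {Open≠∅} λ O → ⋁ em {Pts (proj₁ O)} λ q → φ (proj₁ q)

  _≐_ : Val → Val → 𝟛
  v ≐ v' = if? (em (v ≡ v')) 𝐭 𝐟

  Exists Forall : (Val → 𝟛) → 𝟛
  Exists φ = ⋁ em φ
  Forall φ = ⋀ em φ

  Exists01 : (Val → 𝟛) → 𝟛
  Exists01 φ = ⋀ em {Val × Val} λ vv →
                 (φ (proj₁ vv) ∧₃ φ (proj₂ vv)) →w (proj₁ vv ≐ proj₂ vv)

  Exists1 : (Val → 𝟛) → 𝟛
  Exists1 φ = Exists01 φ ∧₃ Exists φ

  correct incorrect : (Pt → Val → 𝟛) → Form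
  correct   R p = Forall λ a → 𝖳𝖥 (R p a)
  incorrect R p = Forall λ a → 𝖡 (R p a)

  record ThyBB : Set where
    field
      BrDeliver? : (a : Val) → ⊨ λ p → deliver p a →w Quorum (λ q → ready q a)
      BrReady?   : (a : Val) → ⊨ λ p → ready p a →w Quorum (λ q → echo q a)
      BrEcho?    : (a : Val) → ⊨ λ p → echo p a →w Somewhere (λ q → broadcast q a)
      BrEcho01   : ⊨ λ p → Exists01 (λ a → echo p a)
      BrBroadcast1 : ⊨ λ p → Exists1 (λ a → Somewhere (λ q → broadcast q a))
      BrDeliver! : (a : Val) → ⊨ λ p → Quorum (λ q → ready q a) →w deliver p a
      BrReady!   : (a : Val) → ⊨ λ p → Quorum (λ q → echo q a) →w ready p a
      BrEcho!    : (a : Val) → ⊨ λ p →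
                     Somewhere (λ q → broadcast q a) →w Exists (λ b → echo p b)
      BrReady!!  : (a : Val) → ⊨ λ p → Contraquorum (λ q → ready q a) →w ready p a
      BrCorrect  : ⊨ λ p → Quorum (correct ready) ∧₃ Quorum (correct echo)
      BrCorrect'ready : ⊨ λ p → correct ready p ∨₃ incorrect ready p
      BrCorrect'echo  : ⊨ λ p → correct echo p ∨₃ incorrect echo p
      BrCorrect''     : ⊨ λ p → Everywhere (correct broadcast) ∨₃
                                 Everywhere (incorrect broadcast)

-- Weak implication x →w y is valid exactly when x ≡ 𝐭 forces y to be valid, so
-- (3) and (4) are BrReady! and BrDeliver! applied at every point, and (2) is (1)
-- at every point.  For (1), suppose broadcast(v) is
-- 𝐭 somewhere.  By BrEcho! the point p echoes some b.  If p's echo is incorrect,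
-- echo(v) is 𝐛 at p.  If it is correct, echo(b) is 𝐭, so by BrEcho? broadcast(b)
-- holds somewhere; broadcast cannot be everywhere incorrect (it is 𝐭 at some
-- point), so it is everywhere two-valued and broadcast(b) is 𝐭 somewhere.  The
-- uniqueness half of BrBroadcast1 then gives b ≡ v.
module Submission where

open import Defs
open import Data.Product using (_×_; Σ; _,_)
open import Data.Sum using (_⊎_; inj₁; inj₂)
open import Data.Empty using (⊥-elim)
open import Data.Unit using (tt)
open import Relation.Nullary using (yes; no)
open import Relation.Binary.PropositionalEquality using (_≡_; _≢_; refl; sym; trans; subst)

𝐭≢𝐛 : 𝐭 ≢ 𝐛
𝐭≢𝐛 ()

TwoValued : 𝟛 → Set
TwoValued x = x ≡ 𝐭 ⊎ x ≡ 𝐟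

valid-≡𝐭 : ∀ {x} → x ≡ 𝐭 → Valid x
valid-≡𝐭 refl = tt

valid-≡𝐛 : ∀ {x} → x ≡ 𝐛 → Valid x
valid-≡𝐛 refl = tt

twoValued∧valid⇒≡𝐭 : ∀ {x} → TwoValued x → Valid x → x ≡ 𝐭
twoValued∧valid⇒≡𝐭 (inj₁ x≡𝐭) _ = x≡𝐭
twoValued∧valid⇒≡𝐭 (inj₂ refl) ()

valid-∨⁻ : ∀ x y → Valid (x ∨₃ y) → Valid x ⊎ Valid y
valid-∨⁻ 𝐟 y v = inj₂ v
valid-∨⁻ 𝐛 y v = inj₁ tt
valid-∨⁻ 𝐭 y v = inj₁ tt

valid-∧⁻ˡ : ∀ x y → Valid (x ∧₃ y) → Valid x
valid-∧⁻ˡ 𝐛 𝐛 v = tt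
valid-∧⁻ˡ 𝐛 𝐭 v = tt
valid-∧⁻ˡ 𝐭 y v = tt

valid-→w⁻ : ∀ x y → Valid (x →w y) → x ≡ 𝐭 → Valid y
valid-→w⁻ .𝐭 y v refl = v

valid-→w⁺ : ∀ x y → (x ≡ 𝐭 → Valid y) → Valid (x →w y)
valid-→w⁺ 𝐟 y f = tt
valid-→w⁺ 𝐛 𝐟 f = tt
valid-→w⁺ 𝐛 𝐛 f = tt
valid-→w⁺ 𝐛 𝐭 f = tt
valid-→w⁺ 𝐭 y f = f refl

valid-𝖳𝖥⁻ : ∀ x → Valid (𝖳𝖥 x) → TwoValued x
valid-𝖳𝖥⁻ 𝐟 v = inj₂ refl
valid-𝖳𝖥⁻ 𝐭 v = inj₁ refl

valid-𝖡⁻ : ∀ x → Valid (𝖡 x) → x ≡ 𝐛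
valid-𝖡⁻ 𝐛 v = refl

module _ (em : EM) {I : Set} (g : I → 𝟛) where

  valid-⋀⁻ : Valid (⋀ em g) → (i : I) → Valid (g i)
  valid-⋀⁻ v i with em ((i : I) → g i ≡ 𝐭)
  ... | yes all𝐭 = valid-≡𝐭 (all𝐭 i)
  ... | no _ with em ((i : I) → Valid (g i))
  ...   | yes allValid = allValid i
  ...   | no _ = ⊥-elim v

  valid-⋀⁺ : ((i : I) → Valid (g i)) → Valid (⋀ em g)
  valid-⋀⁺ allValid with em ((i : I) → g i ≡ 𝐭)
  ... | yes _ = tt
  ... | no _ with em ((i : I) → Valid (g i))
  ...   | yes _ = tt
  ...   | no ¬allValid = ⊥-elim (¬allValid allValid)

  valid-⋁⁻ : Valid (⋁ em g) → Σ I λ i → Valid (g i)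
  valid-⋁⁻ v with em (Σ I λ i → g i ≡ 𝐭)
  ... | yes (i , gi≡𝐭) = i , valid-≡𝐭 gi≡𝐭
  ... | no _ with em (Σ I λ i → Valid (g i))
  ...   | yes someValid = someValid
  ...   | no _ = ⊥-elim v

  ⋁≡𝐭⁻ : ⋁ em g ≡ 𝐭 → Σ I λ i → g i ≡ 𝐭
  ⋁≡𝐭⁻ eq with em (Σ I λ i → g i ≡ 𝐭)
  ... | yes some𝐭 = some𝐭
  ... | no _ with em (Σ I λ i → Valid (g i)) | eq
  ...   | yes _ | ()
  ...   | no _  | ()

  ⋁≡𝐭⁺ : (i : I) → g i ≡ 𝐭 → ⋁ em g ≡ 𝐭
  ⋁≡𝐭⁺ i gi≡𝐭 with em (Σ I λ i → g i ≡ 𝐭)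
  ... | yes _ = refl
  ... | no ¬some𝐭 = ⊥-elim (¬some𝐭 (i , gi≡𝐭))

  ⋁-twoValued : ((i : I) → TwoValued (g i)) → Valid (⋁ em g) → ⋁ em g ≡ 𝐭
  ⋁-twoValued twoValued v with valid-⋁⁻ v
  ... | i , gi = ⋁≡𝐭⁺ i (twoValued∧valid⇒≡𝐭 (twoValued i) gi)

valid-if?⁻ : (em : EM) {A : Set} → Valid (if? (em A) 𝐭 𝐟) → A
valid-if?⁻ em {A} v with em A
... | yes a = a
... | no _ = ⊥-elim v

module _ (em : EM) (M : Model) where
  open Sem em M

  valid-→w-Everywhere : ∀ x (φ : Form) → (∀ p → x ≡ 𝐭 → Valid (φ p)) →
                        ⊨ λ _ → x →w Everywhere φ
  valid-→w-Everywhere x φ φ-valid _ =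
    valid-→w⁺ x _ λ x≡𝐭 → valid-⋀⁺ em φ λ p → φ-valid p x≡𝐭

  module ThyBB-consequences (T : ThyBB) where
    open ThyBB T

    SomewhereBroadcast : Val → 𝟛
    SomewhereBroadcast a = Somewhere λ q → broadcast q a

    broadcast-twoValued : ∀ {v} → SomewhereBroadcast v ≡ 𝐭 →
                          ∀ q a → TwoValued (broadcast q a)
    broadcast-twoValued {v} sb q a with ⋁≡𝐭⁻ em (λ q → broadcast q v) sb
    ... | q′ , broadcast𝐭 with valid-∨⁻ _ _ (BrCorrect'' q′)
    ...   | inj₁ correct = valid-𝖳𝖥⁻ _ (valid-⋀⁻ em _ (valid-⋀⁻ em _ correct q) a)
    ...   | inj₂ incorrect = ⊥-elim (𝐭≢𝐛 (trans (sym broadcast𝐭) broadcast𝐛))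
      where
        broadcast𝐛 : broadcast q′ v ≡ 𝐛
        broadcast𝐛 = valid-𝖡⁻ _ (valid-⋀⁻ em _ (valid-⋀⁻ em _ incorrect q′) v)

    somewhereBroadcast-unique : ∀ {a b} → Pt →
                                SomewhereBroadcast a ≡ 𝐭 → SomewhereBroadcast b ≡ 𝐭 →
                                a ≡ b
    somewhereBroadcast-unique {a} {b} p sa sb =
      valid-if?⁻ em (valid-→w⁻ _ _ at-most-one both)
      where
        at-most-one : Valid ((SomewhereBroadcast a ∧₃ SomewhereBroadcast b) →w (a ≐ b))
        at-most-one = valid-⋀⁻ em _ (valid-∧⁻ˡ _ _ (BrBroadcast1 p)) (a , b)
        both : SomewhereBroadcast a ∧₃ SomewhereBroadcast b ≡ 𝐭
        both rewrite sa | sb = refl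

    somewhereBroadcast⇒echo : ∀ {v} p → SomewhereBroadcast v ≡ 𝐭 → Valid (echo p v)
    somewhereBroadcast⇒echo {v} p sv
      with valid-⋁⁻ em (λ b → echo p b) (valid-→w⁻ _ _ (BrEcho! v p) sv)
    ... | b , echo-b with valid-∨⁻ _ _ (BrCorrect'echo p)
    ...   | inj₂ incorrect = valid-≡𝐛 (valid-𝖡⁻ _ (valid-⋀⁻ em _ incorrect v))
    ...   | inj₁ correct = subst (λ a → Valid (echo p a)) b≡v echo-b
      where
        echo-b≡𝐭 : echo p b ≡ 𝐭
        echo-b≡𝐭 = twoValued∧valid⇒≡𝐭 (valid-𝖳𝖥⁻ _ (valid-⋀⁻ em _ correct b)) echo-b
        sb : SomewhereBroadcast b ≡ 𝐭
        sb = ⋁-twoValued em (λ q → broadcast q b)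
               (λ q → broadcast-twoValued sv q b)
               (valid-→w⁻ _ _ (BrEcho? b p) echo-b≡𝐭)
        b≡v : b ≡ v
        b≡v = somewhereBroadcast-unique p sb sv

lemma4p12 : (em : EM) (M : Model) → ThreeTwined (Model.space M) →
    let open Sem em M in
    ThyBB → (v : Val) →
      (⊨ λ p → Somewhere (λ q → broadcast q v) →w echo p v)
    × (⊨ λ p → Somewhere (λ q → broadcast q v) →w Everywhere (λ q → echo q v))
    × (⊨ λ p → Quorum (λ q → echo q v) →w Everywhere (λ q → ready q v))
    × (⊨ λ p → Quorum (λ q → ready q v) →w Everywhere (λ q → deliver q v))
lemma4p12 em M _ T v =
    (λ p → valid-→w⁺ _ _ (somewhereBroadcast⇒echo p))
  , valid-→w-Everywhere em M _ _ somewhereBroadcast⇒echo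
  , valid-→w-Everywhere em M _ _ (λ q → valid-→w⁻ _ _ (BrReady! v q))
  , valid-→w-Everywhere em M _ _ (λ q → valid-→w⁻ _ _ (BrDeliver! v q))
  where
    open Sem em M
    open ThyBB T
    open ThyBB-consequences em M T
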